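{- Fix $k\in\mathbb{P}$. Let $F_n$ be the Fibonacci polynomials, $F_0(x)=1$, $F_1(x)=x$, $F_n(x)=xF_{n-1}(x)+F_{n-2}(x)$ for $n\ge2$, and let $G_n=G_n^{(k)}(x)$ be defined by $G_0=-1$, $G_1=x-1$, $G_n=x^kG_{n-1}+G_{n-2}$ for $n\ge2$. Then for every $n\ge 2$, $$G_n^{(k)}(x)=\frac{G_{n-1}^{(k)}(x)\,F_{n-1}(x^k)+(-1)^{n-1}}{F_{n-2}(x^k)}.$$
   Context: $\mathbb{P}$ denotes the set of positive integers. -}

module Defs where

open import Algebra.Bundles using (CommutativeRing)
open import Data.Nat using (ℕ; zero; suc)

-- Polynomial identities with integer coefficients are stated in an arbitrary
-- commutative ring R at an arbitrary element x (taking R = ℤ[X], x = X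
-- recovers the polynomial identity).
module FibDefs {c ℓ} (R : CommutativeRing c ℓ) where
  open CommutativeRing R

  pow : Carrier → ℕ → Carrier
  pow x zero    = 1#
  pow x (suc n) = x * pow x n

  F : ℕ → Carrier → Carrier
  F zero          x = 1#
  F (suc zero)    x = x
  F (suc (suc n)) x = x * F (suc n) x + F n x

  G : ℕ → ℕ → Carrier → Carrier
  G k zero          x = - 1#
  G k (suc zero)    x = x - 1#
  G k (suc (suc n)) x = pow x k * G k (suc n) x + G k n x

{-# OPTIONS --safe #-}
-- G^{(k)} and F(x^k) satisfy the same second-order recurrence u (n+2) = y u (n+1) + u n
-- with y = x^k, and for any two solutions u, v of such a recurrence the cross
-- determinant u (m+1) v m - u m v (m+1) changes sign at every step.  For the shifted
-- sequence u n = G (n+1) and v n = F n the initial determinant is G 2 - G 1 x^k = -1,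
-- which gives the identity with the sign (-1)^(n-1).  The argument does not use 1 ≤ k.
module Submission where

open import Algebra.Bundles using (CommutativeRing)
import Algebra.Properties.Ring as RingProperties
open import Data.Maybe using (nothing)
open import Data.Nat using (ℕ; _≤_; _∸_; zero; suc; s≤s)
open import Defs
import Relation.Binary.Reasoning.Setoid as SetoidReasoning

module SecondOrderRecurrence {c ℓ} (R : CommutativeRing c ℓ) where
  open CommutativeRing R
  open FibDefs R using (pow)
  open SetoidReasoning setoid
  open import Algebra.Solver.Ring.NaturalCoefficients commutativeSemiring (λ _ _ → nothing)
  open RingProperties ring using (+-cancelʳ; -1*x≈-x)

  Solves : Carrier → (ℕ → Carrier) → Set ℓ
  Solves y u = ∀ n → u (suc (suc n)) ≈ y * u (suc n) + u n

  -1*x+x≈0 : ∀ x → (- 1#) * x + x ≈ 0#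
  -1*x+x≈0 x = trans (+-congʳ (-1*x≈-x x)) (-‿inverseˡ x)

  -- The solver only knows the semiring structure; adding a * d to both sides turns
  -- the sign change into the subtraction-free identity swap.
  cross-determinant-step : ∀ y a b c d p → a * d ≈ b * c + p →
                           (y * a + b) * c ≈ a * (y * c + d) + (- 1#) * p
  cross-determinant-step y a b c d p ad≈bc+p = +-cancelʳ (a * d) _ _ (begin
    (y * a + b) * c + a * d                        ≈⟨ swap y a b c d ⟩
    a * (y * c + d) + b * c                        ≈⟨ +-congˡ (sym (+-identityʳ (b * c))) ⟩
    a * (y * c + d) + (b * c + 0#)                 ≈⟨ +-congˡ (+-congˡ (sym (-1*x+x≈0 p))) ⟩
    a * (y * c + d) + (b * c + ((- 1#) * p + p))   ≈⟨ regroup (a * (y * c + d)) (b * c) ((- 1#) * p) p ⟩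
    a * (y * c + d) + (- 1#) * p + (b * c + p)     ≈⟨ +-congˡ (sym ad≈bc+p) ⟩
    a * (y * c + d) + (- 1#) * p + a * d           ∎)
    where
    swap : ∀ y a b c d → (y * a + b) * c + a * d ≈ a * (y * c + d) + b * c
    swap = solve 5 (λ y a b c d → (y :* a :+ b) :* c :+ a :* d
                      := a :* (y :* c :+ d) :+ b :* c) refl
    regroup : ∀ s t q p → s + (t + (q + p)) ≈ s + q + (t + p)
    regroup = solve 4 (λ s t q p → s :+ (t :+ (q :+ p)) := s :+ q :+ (t :+ p)) refl

  cross-determinant-alternates :
    ∀ {y} u v D → Solves y u → Solves y v → u 1 * v 0 ≈ u 0 * v 1 + D →
    ∀ m → u (suc m) * v m ≈ u m * v (suc m) + pow (- 1#) m * D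
  cross-determinant-alternates u v D u-rec v-rec base zero =
    trans base (+-congˡ (sym (*-identityˡ D)))
  cross-determinant-alternates {y} u v D u-rec v-rec base (suc m) = begin
    u (suc (suc m)) * v (suc m)                           ≈⟨ *-congʳ (u-rec m) ⟩
    (y * u (suc m) + u m) * v (suc m)                     ≈⟨ cross-determinant-step y _ _ _ _ _ ih ⟩
    u (suc m) * (y * v (suc m) + v m) + (- 1#) * (pow (- 1#) m * D)
                                                          ≈⟨ +-cong (*-congˡ (sym (v-rec m))) (sym (*-assoc _ _ D)) ⟩
    u (suc m) * v (suc (suc m)) + pow (- 1#) (suc m) * D  ∎
    where
    ih : u (suc m) * v m ≈ u m * v (suc m) + pow (- 1#) m * D
    ih = cross-determinant-alternates u v D u-rec v-rec base m

fact3 : ∀ {c ℓ} (R : CommutativeRing c ℓ) → let open CommutativeRing R in let open FibDefs R in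
    (k : ℕ) → 1 ≤ k → (n : ℕ) → 2 ≤ n → (x : Carrier) →
    G k n x * F (n ∸ 2) (pow x k) ≈ G k (n ∸ 1) x * F (n ∸ 1) (pow x k) + pow (- 1#) (n ∸ 1)
fact3 R k _ (suc (suc m)) (s≤s (s≤s _)) x =
  trans (cross-determinant-alternates (λ n → G k (suc n) x) (λ n → F n (pow x k)) (- 1#)
           (λ _ → refl) (λ _ → refl) initial m)
        (+-congˡ (*-comm (pow (- 1#) m) (- 1#)))
  where
  open CommutativeRing R
  open FibDefs R
  open SecondOrderRecurrence R
  initial : G k 2 x * F 0 (pow x k) ≈ G k 1 x * F 1 (pow x k) + - 1#
  initial = trans (*-identityʳ _) (+-congʳ (*-comm (pow x k) (x - 1#)))
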